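{- Let $A$ be a finite abelian group and $S,T\subseteq A$. If ${\rm Haar}(A,S)$ and ${\rm Haar}(A,T)$ are isomorphic by an element of $N_{S_{{\mathbb Z}_2\times A}}(\widehat A_L)$, then they are isomorphic by an element of $N_{S_{{\mathbb Z}_2\times A}}(\widehat A_L)$ of the form $\widehat\alpha\bar a$ with $\alpha\in{\rm Aut}(A)$ and $a\in A$.
   Context: $A$ is written additively; permutations compose right to left. ${\rm Haar}(A,S)$ has vertex set ${\mathbb Z}_2\times A$ and edge set $\{(0,g)(1,g+s):g\in A,s\in S\}$. For $a\in A$, $\widehat a_L(i,x)=(i,a+x)$, $\widehat A_L=\{\widehat a_L:a\in A\}$, and $\bar a(0,x)=(0,x)$, $\bar a(1,x)=(1,x-a)$; for $\alpha\in{\rm Aut}(A)$, $\widehat\alpha(i,x)=(i,\alpha(x))$. Two graphs on ${\mathbb Z}_2\times A$ are isomorphic by $\phi$ if $\phi$ maps one onto the other. -}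

module Defs where

open import Level using (0ℓ)
open import Data.Nat using (ℕ)
open import Data.Fin using (Fin; zero; suc)
open import Data.Product using (Σ; ∃; _×_; _,_)
open import Data.Empty using (⊥)
open import Relation.Unary using (Pred; _∈_)
open import Relation.Binary.PropositionalEquality using (_≡_)
open import Algebra.Structures using (IsAbelianGroup)
open import Function.Bundles using (_↔_; Inverse; _⇔_)

record FiniteAbelianGroup : Set₁ where
  infixl 6 _+_
  field
    Carrier        : Set
    _+_            : Carrier → Carrier → Carrier
    0#             : Carrier
    -_             : Carrier → Carrier
    isAbelianGroup : IsAbelianGroup _≡_ _+_ 0# -_
    size           : ℕ
    enum           : Carrier ↔ Fin size

  _-_ : Carrier → Carrier → Carrier
  x - y = x + (- y)

module _ (G : FiniteAbelianGroup) where
  open FiniteAbelianGroup G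

  V : Set
  V = Fin 2 × Carrier

  HaarAdj : Pred Carrier 0ℓ → V → V → Set
  HaarAdj S (zero , g) (suc zero , h) = Σ Carrier λ s → s ∈ S × h ≡ g + s
  HaarAdj S (suc zero , h) (zero , g) = Σ Carrier λ s → s ∈ S × h ≡ g + s
  HaarAdj S _ _ = ⊥

  IsIsoBy : (V ↔ V) → Pred Carrier 0ℓ → Pred Carrier 0ℓ → Set
  IsIsoBy φ S T = ∀ u v → HaarAdj S u v ⇔ HaarAdj T (Inverse.to φ u) (Inverse.to φ v)

  hatL : Carrier → V → V
  hatL a (i , x) = (i , a + x)

  bar : Carrier → V → V
  bar a (zero , x) = (zero , x)
  bar a (suc i , x) = (suc i , x - a)

  hat : (Carrier → Carrier) → V → V
  hat α (i , x) = (i , α x)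

  IsAutomorphism : (Carrier ↔ Carrier) → Set
  IsAutomorphism α = ∀ x y → Inverse.to α (x + y) ≡ Inverse.to α x + Inverse.to α y

  InNormalizer : (V ↔ V) → Set
  InNormalizer φ =
      (∀ a → ∃ λ b → ∀ v → Inverse.to φ (hatL a (Inverse.from φ v)) ≡ hatL b v)
    × (∀ b → ∃ λ a → ∀ v → Inverse.to φ (hatL a (Inverse.from φ v)) ≡ hatL b v)

{-# OPTIONS --safe #-}
module Submission where

-- Conjugation by φ sends each translation â_L to (σ a)_L for an automorphism σ of A, so
-- φ (i , x) = (side i , σ x + offset i), and as φ is onto, the two sides go to different sides.
-- Reading the edge (0,0)(1,s) through φ gives s ∈ S ⇔ ±(σ s + offset 1 - offset 0) ∈ T, the sign
-- recording whether φ swaps the sides. With α = ±σ and a = σ⁻¹ (offset 0 - offset 1) this says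
-- x ∈ S ⇔ α (x - a) ∈ T, which is exactly when α̂ ā maps Haar(A,S) onto Haar(A,T); and α̂ ā
-- normalises Â_L because it conjugates â_L to (α a)_L.

open import Defs
open import Data.Product using (Σ; _×_; _,_; proj₁; proj₂)
open import Level using (0ℓ)
open import Relation.Unary using (Pred; _∈_)
open import Relation.Binary.PropositionalEquality using (_≡_; _≢_; refl; sym; trans; cong; subst; module ≡-Reasoning)
open import Relation.Nullary using (contradiction)
open import Function.Bundles using (_↔_; Inverse; _⇔_; mk⇔; mk↔ₛ′; Injection)
open import Function.Construct.Composition using (_↔-∘_)
open import Function.Construct.Identity using (⇔-id)
open import Function.Construct.Symmetry using (⇔-sym)
open import Function.Properties.Inverse using (↔⇒↣)
open import Function.Related.Propositional using (module EquationalReasoning; equivalence)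
open import Data.Fin using (Fin; zero; suc)
open import Data.Fin.Properties using (0≢1+n)
open import Algebra.Bundles using (AbelianGroup)
import Algebra.Properties.AbelianGroup as AbelianGroupProperties
import Algebra.Properties.CommutativeSemigroup as CommutativeSemigroupProperties

open Inverse using (to; from; strictlyInverseˡ; strictlyInverseʳ)

module _ (G : FiniteAbelianGroup) where
  open FiniteAbelianGroup G

  private
    abelianGroup : AbelianGroup 0ℓ 0ℓ
    abelianGroup = record { isAbelianGroup = isAbelianGroup }

  open AbelianGroup abelianGroup using (assoc; comm; identityʳ; commutativeSemigroup)
  open AbelianGroupProperties abelianGroup
    using ( x≈z//y; //-rightDividesˡ; //-rightDividesʳ; ∙-cancelʳ
          ; ⁻¹-anti-homo‿-; ⁻¹-∙-comm; ⁻¹-involutive; ε⁻¹≈ε )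
  open CommutativeSemigroupProperties commutativeSemigroup using (xy∙z≈xz∙y)

  automorphism-sub : ∀ {α} → IsAutomorphism G α → ∀ x y → to α (x - y) ≡ to α x - to α y
  automorphism-sub {α} α-hom x y =
    x≈z//y (to α (x - y)) (to α y) (to α x)
      (trans (sym (α-hom (x - y) y)) (cong (to α) (//-rightDividesˡ y x)))

  ∘-isAutomorphism : ∀ {α β} → IsAutomorphism G α → IsAutomorphism G β → IsAutomorphism G (β ↔-∘ α)
  ∘-isAutomorphism {α} {β} α-hom β-hom x y = trans (cong (to β) (α-hom x y)) (β-hom (to α x) (to α y))

  signed : Fin 2 → Carrier → Carrier
  signed zero       x = x
  signed (suc zero) x = - x

  signed-involutive : ∀ i x → signed i (signed i x) ≡ x
  signed-involutive zero       x = refl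
  signed-involutive (suc zero) x = ⁻¹-involutive x

  signed↔ : Fin 2 → Carrier ↔ Carrier
  signed↔ i = mk↔ₛ′ (signed i) (signed i) (signed-involutive i) (signed-involutive i)

  signed-isAutomorphism : ∀ i → IsAutomorphism G (signed↔ i)
  signed-isAutomorphism zero       x y = refl
  signed-isAutomorphism (suc zero) x y = sym (⁻¹-∙-comm x y)

  hatL-cancelʳ : ∀ {a b} v → hatL G a v ≡ hatL G b v → a ≡ b
  hatL-cancelʳ {a} {b} (_ , x) eq = ∙-cancelʳ x a b (cong proj₂ eq)

  hatL-hatL : ∀ a b v → hatL G a (hatL G b v) ≡ hatL G (a + b) v
  hatL-hatL a b (i , x) = cong (i ,_) (sym (assoc a b x))

  HaarAdj⇔difference : ∀ S x y → HaarAdj G S (zero , x) (suc zero , y) ⇔ (y - x ∈ S)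
  HaarAdj⇔difference S x y = mk⇔ difference∈S adjacent
    where
    difference∈S : HaarAdj G S (zero , x) (suc zero , y) → y - x ∈ S
    difference∈S (s , s∈S , y≡x+s) = subst S (x≈z//y s x y (trans (comm s x) (sym y≡x+s))) s∈S
    adjacent : y - x ∈ S → HaarAdj G S (zero , x) (suc zero , y)
    adjacent y-x∈S = y - x , y-x∈S , sym (trans (comm x (y - x)) (//-rightDividesˡ x y))

  HaarAdj⇔signedDifference : ∀ S {i j} → i ≢ j → ∀ x y →
    HaarAdj G S (i , x) (j , y) ⇔ (signed i (y - x) ∈ S)
  HaarAdj⇔signedDifference S {zero}     {zero}     i≢j x y = contradiction refl i≢j
  HaarAdj⇔signedDifference S {zero}     {suc zero} i≢j x y = HaarAdj⇔difference S x y
  HaarAdj⇔signedDifference S {suc zero} {zero}     i≢j x y = begin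
    HaarAdj G S (zero , y) (suc zero , x)  ∼⟨ HaarAdj⇔difference S y x ⟩
    x - y ∈ S                              ≡⟨ cong (_∈ S) (sym (⁻¹-anti-homo‿- y x)) ⟩
    - (y - x) ∈ S                          ∎
    where open EquationalReasoning {k = equivalence}
  HaarAdj⇔signedDifference S {suc zero} {suc zero} i≢j x y = contradiction refl i≢j

  conjugatesTranslations⇒inNormalizer : ∀ φ (σ : Carrier ↔ Carrier) →
    (∀ b v → to φ (hatL G b (from φ v)) ≡ hatL G (to σ b) v) → InNormalizer G φ
  conjugatesTranslations⇒inNormalizer φ σ conj =
      (λ b → to σ b , conj b)
    , (λ b → from σ b , λ v → trans (conj (from σ b) v) (cong (λ c → hatL G c v) (strictlyInverseˡ σ b)))

  module _ (α : Carrier ↔ Carrier) (a : Carrier) where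

    hatBar : V G → V G
    hatBar v = hat G (to α) (bar G a v)

    hatBar⁻¹ : V G → V G
    hatBar⁻¹ (zero     , y) = zero , from α y
    hatBar⁻¹ (suc zero , y) = suc zero , from α y + a

    hatBar-hatBar⁻¹ : ∀ v → hatBar (hatBar⁻¹ v) ≡ v
    hatBar-hatBar⁻¹ (zero     , y) = cong (zero ,_) (strictlyInverseˡ α y)
    hatBar-hatBar⁻¹ (suc zero , y) =
      cong (suc zero ,_) (trans (cong (to α) (//-rightDividesʳ a (from α y))) (strictlyInverseˡ α y))

    hatBar⁻¹-hatBar : ∀ v → hatBar⁻¹ (hatBar v) ≡ v
    hatBar⁻¹-hatBar (zero     , x) = cong (zero ,_) (strictlyInverseʳ α x)
    hatBar⁻¹-hatBar (suc zero , x) =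
      cong (suc zero ,_) (trans (cong (_+ a) (strictlyInverseʳ α (x - a))) (//-rightDividesˡ a x))

    hatBar↔ : V G ↔ V G
    hatBar↔ = mk↔ₛ′ hatBar hatBar⁻¹ hatBar-hatBar⁻¹ hatBar⁻¹-hatBar

    module _ (α-hom : IsAutomorphism G α) where

      hatBar-conjugatesTranslations : ∀ b v → hatBar (hatL G b (hatBar⁻¹ v)) ≡ hatL G (to α b) v
      hatBar-conjugatesTranslations b (zero     , y) =
        cong (zero ,_) (trans (α-hom b (from α y)) (cong (to α b +_) (strictlyInverseˡ α y)))
      hatBar-conjugatesTranslations b (suc zero , y) = cong (suc zero ,_) (begin
        to α ((b + (from α y + a)) - a)  ≡⟨ cong (λ z → to α (z - a)) (sym (assoc b (from α y) a)) ⟩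
        to α ((b + from α y + a) - a)    ≡⟨ cong (to α) (//-rightDividesʳ a (b + from α y)) ⟩
        to α (b + from α y)              ≡⟨ α-hom b (from α y) ⟩
        to α b + to α (from α y)         ≡⟨ cong (to α b +_) (strictlyInverseˡ α y) ⟩
        to α b + y                       ∎)
        where open ≡-Reasoning

      hatBar-inNormalizer : InNormalizer G hatBar↔
      hatBar-inNormalizer = conjugatesTranslations⇒inNormalizer hatBar↔ α hatBar-conjugatesTranslations

      hatBar-isIsoBy : ∀ S T → (∀ x → x ∈ S ⇔ to α (x - a) ∈ T) → IsIsoBy G hatBar↔ S T
      hatBar-isIsoBy S T S⇔T = λ where
          (zero     , g) (zero     , h) → ⇔-id _
          (zero     , g) (suc zero , h) → across g h
          (suc zero , h) (zero     , g) → across g h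
          (suc zero , g) (suc zero , h) → ⇔-id _
        where
        open EquationalReasoning {k = equivalence}
        across : ∀ g h →
          HaarAdj G S (zero , g) (suc zero , h) ⇔ HaarAdj G T (zero , to α g) (suc zero , to α (h - a))
        across g h = begin
          HaarAdj G S (zero , g) (suc zero , h)              ∼⟨ HaarAdj⇔difference S g h ⟩
          h - g ∈ S                                          ∼⟨ S⇔T (h - g) ⟩
          to α ((h - g) - a) ∈ T                             ≡⟨ cong (λ z → to α z ∈ T) (xy∙z≈xz∙y h (- g) (- a)) ⟩
          to α ((h - a) - g) ∈ T                             ≡⟨ cong (_∈ T) (automorphism-sub {α} α-hom (h - a) g) ⟩
          to α (h - a) - to α g ∈ T                          ∼⟨ ⇔-sym (HaarAdj⇔difference T (to α g) (to α (h - a))) ⟩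
          HaarAdj G T (zero , to α g) (suc zero , to α (h - a)) ∎

  module NormalizerElement (φ : V G ↔ V G) (φ-normal : InNormalizer G φ) where

    σ σ⁻¹ : Carrier → Carrier
    σ   b = proj₁ (proj₁ φ-normal b)
    σ⁻¹ b = proj₁ (proj₂ φ-normal b)

    to-hatL : ∀ b w → to φ (hatL G b w) ≡ hatL G (σ b) (to φ w)
    to-hatL b w = begin
      to φ (hatL G b w)                   ≡⟨ cong (λ u → to φ (hatL G b u)) (strictlyInverseʳ φ w) ⟨
      to φ (hatL G b (from φ (to φ w)))   ≡⟨ proj₂ (proj₁ φ-normal b) (to φ w) ⟩
      hatL G (σ b) (to φ w)               ∎
      where open ≡-Reasoning

    to-translate : ∀ i x → to φ (i , x) ≡ hatL G (σ x) (to φ (i , 0#))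
    to-translate i x = trans (cong (λ y → to φ (i , y)) (sym (identityʳ x))) (to-hatL x (i , 0#))

    σ-inverseˡ : ∀ b → σ (σ⁻¹ b) ≡ b
    σ-inverseˡ b = hatL-cancelʳ v₀ (begin
      hatL G (σ (σ⁻¹ b)) v₀                         ≡⟨ cong (hatL G (σ (σ⁻¹ b))) (strictlyInverseˡ φ v₀) ⟨
      hatL G (σ (σ⁻¹ b)) (to φ (from φ v₀))         ≡⟨ to-hatL (σ⁻¹ b) (from φ v₀) ⟨
      to φ (hatL G (σ⁻¹ b) (from φ v₀))             ≡⟨ proj₂ (proj₂ φ-normal b) v₀ ⟩
      hatL G b v₀                                   ∎)
      where
      open ≡-Reasoning
      v₀ : V G
      v₀ = zero , 0#

    σ-injective : ∀ {x y} → σ x ≡ σ y → x ≡ y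
    σ-injective {x} {y} σx≡σy = cong proj₂ (Injection.injective (↔⇒↣ φ) (begin
      to φ (zero , x)                        ≡⟨ to-translate zero x ⟩
      hatL G (σ x) (to φ (zero , 0#))        ≡⟨ cong (λ c → hatL G c (to φ (zero , 0#))) σx≡σy ⟩
      hatL G (σ y) (to φ (zero , 0#))        ≡⟨ to-translate zero y ⟨
      to φ (zero , y)                        ∎))
      where open ≡-Reasoning

    σ↔ : Carrier ↔ Carrier
    σ↔ = mk↔ₛ′ σ σ⁻¹ σ-inverseˡ (λ b → σ-injective (σ-inverseˡ (σ b)))

    σ-isAutomorphism : IsAutomorphism G σ↔
    σ-isAutomorphism x y = hatL-cancelʳ (to φ (zero , 0#)) (begin
      hatL G (σ (x + y)) (to φ (zero , 0#))                  ≡⟨ to-translate zero (x + y) ⟨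
      to φ (hatL G x (zero , y))                             ≡⟨ to-hatL x (zero , y) ⟩
      hatL G (σ x) (to φ (zero , y))                         ≡⟨ cong (hatL G (σ x)) (to-translate zero y) ⟩
      hatL G (σ x) (hatL G (σ y) (to φ (zero , 0#)))         ≡⟨ hatL-hatL (σ x) (σ y) (to φ (zero , 0#)) ⟩
      hatL G (σ x + σ y) (to φ (zero , 0#))                  ∎)
      where open ≡-Reasoning

    -- By to-translate, φ (i , x) = (side i , σ x + offset i).
    side : Fin 2 → Fin 2
    side i = proj₁ (to φ (i , 0#))

    offset : Fin 2 → Carrier
    offset i = proj₂ (to φ (i , 0#))

    sides-differ : side zero ≢ side (suc zero)
    sides-differ same = 0≢1+n (trans (lands-on-side₀ (zero , 0#)) (sym (lands-on-side₀ (suc zero , 0#))))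
      where
      maps-to-side₀ : ∀ w → proj₁ (to φ w) ≡ side zero
      maps-to-side₀ (zero     , x) = cong proj₁ (to-translate zero x)
      maps-to-side₀ (suc zero , x) = trans (cong proj₁ (to-translate (suc zero) x)) (sym same)
      lands-on-side₀ : ∀ v → proj₁ v ≡ side zero
      lands-on-side₀ v = trans (cong proj₁ (sym (strictlyInverseˡ φ v))) (maps-to-side₀ (from φ v))

    α : Carrier ↔ Carrier
    α = signed↔ (side zero) ↔-∘ σ↔

    α-isAutomorphism : IsAutomorphism G α
    α-isAutomorphism =
      ∘-isAutomorphism {σ↔} {signed↔ (side zero)} σ-isAutomorphism (signed-isAutomorphism (side zero))

    a : Carrier
    a = σ⁻¹ (offset zero - offset (suc zero))

    offsets≡σ[s-a] : ∀ s → (σ s + offset (suc zero)) - offset zero ≡ σ (s - a)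
    offsets≡σ[s-a] s = begin
      (σ s + c₁) - c₀    ≡⟨ assoc (σ s) c₁ (- c₀) ⟩
      σ s + (c₁ - c₀)    ≡⟨ cong (σ s +_) (⁻¹-anti-homo‿- c₀ c₁) ⟨
      σ s - (c₀ - c₁)    ≡⟨ cong (λ z → σ s - z) (σ-inverseˡ (c₀ - c₁)) ⟨
      σ s - σ a          ≡⟨ automorphism-sub {σ↔} σ-isAutomorphism s a ⟨
      σ (s - a)          ∎
      where
      open ≡-Reasoning
      c₀ c₁ : Carrier
      c₀ = offset zero
      c₁ = offset (suc zero)

    isIsoBy⇒hatBarCriterion : ∀ {S T} → IsIsoBy G φ S T → ∀ s → s ∈ S ⇔ to α (s - a) ∈ T
    isIsoBy⇒hatBarCriterion {S} {T} φ-iso s = begin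
      s ∈ S                                                       ≡⟨ cong (_∈ S) (x-0≡x s) ⟨
      s - 0# ∈ S                                                  ∼⟨ ⇔-sym (HaarAdj⇔difference S 0# s) ⟩
      HaarAdj G S (zero , 0#) (suc zero , s)                      ∼⟨ φ-iso (zero , 0#) (suc zero , s) ⟩
      HaarAdj G T (to φ (zero , 0#)) (to φ (suc zero , s))
                                                                  ≡⟨ cong (HaarAdj G T (to φ (zero , 0#))) (to-translate (suc zero) s) ⟩
      HaarAdj G T (side zero , offset zero) (side (suc zero) , σ s + offset (suc zero))
                                                                  ∼⟨ HaarAdj⇔signedDifference T sides-differ _ _ ⟩
      signed (side zero) ((σ s + offset (suc zero)) - offset zero) ∈ T
                                                                  ≡⟨ cong (λ z → signed (side zero) z ∈ T) (offsets≡σ[s-a] s) ⟩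
      signed (side zero) (σ (s - a)) ∈ T                          ∎
      where
      open EquationalReasoning {k = equivalence}
      x-0≡x : ∀ x → x - 0# ≡ x
      x-0≡x x = trans (cong (x +_) ε⁻¹≈ε) (identityʳ x)

mainTheorem5 : (G : FiniteAbelianGroup) → (S T : Pred (FiniteAbelianGroup.Carrier G) 0ℓ) →
    Σ (V G ↔ V G) (λ φ → InNormalizer G φ × IsIsoBy G φ S T) →
    Σ (V G ↔ V G) (λ ψ → InNormalizer G ψ × IsIsoBy G ψ S T
      × Σ (FiniteAbelianGroup.Carrier G ↔ FiniteAbelianGroup.Carrier G) (λ α → IsAutomorphism G α
        × Σ (FiniteAbelianGroup.Carrier G) (λ a → ∀ v → Inverse.to ψ v ≡ hat G (Inverse.to α) (bar G a v))))
mainTheorem5 G S T (φ , φ-normal , φ-iso) =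
    hatBar↔ G α a
  , hatBar-inNormalizer G α a α-isAutomorphism
  , hatBar-isIsoBy G α a α-isAutomorphism S T (isIsoBy⇒hatBarCriterion φ-iso)
  , α , α-isAutomorphism , a , λ _ → refl
  where open NormalizerElement G φ φ-normal
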